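{- Let $t \ge 3$ be an integer and let $G$ be a finite simple connected graph. If $M_t(G)$ is a regular graph, then $M_t(G)$ is not a distance magic graph.
   Context: For a graph $G=(V,E)$ and an integer $t \ge 1$, the generalised Mycielskian $M_t(G)$ is the graph with vertex set $(V \times \{0,1,\dots,t-1\}) \cup \{u\}$ (where $u$ is a new vertex), whose edges are: $(x,0)(y,0)$ for every edge $xy \in E$; $(x,i)(y,i+1)$ for every $0 \le i \le t-2$ and every ordered pair $(x,y)$ with $xy \in E$; and $(x,t-1)u$ for every $x \in V$. A graph $H$ on $N$ vertices is distance magic if there is a bijection $f: V(H) \to \{1,2,\dots,N\}$ and a constant $k$ such that for every vertex $v$, $\sum_{w \in N(v)} f(w) = k$, where $N(v)$ is the open neighbourhood of $v$. -}

module Defs where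

open import Data.Nat using (ℕ; zero; suc; _+_; _*_; _∸_; _≡ᵇ_)
open import Data.Bool using (Bool; true; false; if_then_else_; _∧_; _∨_)
open import Data.Fin using (Fin; toℕ)
open import Data.Product using (Σ; _×_; _,_; ∃; ∃-syntax)
open import Data.Sum using (_⊎_; inj₁; inj₂)
open import Data.Unit using (⊤; tt)
open import Data.List using (List; map; allFin)
open import Data.Nat.ListAction using (sum)
open import Relation.Binary.PropositionalEquality using (_≡_)
open import Function.Bundles using (_⤖_; Bijection)

record SimpleGraph (n : ℕ) : Set where
  field
    adj    : Fin n → Fin n → Bool
    symm   : ∀ x y → adj x y ≡ adj y x
    irrefl : ∀ x → adj x x ≡ false
open SimpleGraph public

data Walk {n : ℕ} (G : SimpleGraph n) : Fin n → Fin n → Set where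
  here : ∀ {x} → Walk G x x
  step : ∀ {x y z} → adj G x y ≡ true → Walk G y z → Walk G x z

-- Connected: at least one vertex, and any two vertices are joined by a walk.
-- (Nonemptiness is included in the standard notion of connected graph.)
Connected : ∀ {n} → SimpleGraph n → Set
Connected {n} G = Fin n × (∀ x y → Walk G x y)

-- Vertex set of M_t(G): V × {0,…,t-1} together with the new vertex u (= inj₂ tt).
MVertex : ℕ → ℕ → Set
MVertex n t = (Fin n × Fin t) ⊎ ⊤

myc-adj : ∀ {n} (t : ℕ) → SimpleGraph n → MVertex n t → MVertex n t → Bool
myc-adj t G (inj₁ (x , i)) (inj₁ (y , j)) =
  adj G x y ∧ ((  (toℕ i ≡ᵇ 0) ∧ (toℕ j ≡ᵇ 0))
              ∨ (toℕ j ≡ᵇ suc (toℕ i))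
              ∨ (toℕ i ≡ᵇ suc (toℕ j)))
myc-adj t G (inj₁ (x , i)) (inj₂ tt) = toℕ i ≡ᵇ (t ∸ 1)
myc-adj t G (inj₂ tt) (inj₁ (y , j)) = toℕ j ≡ᵇ (t ∸ 1)
myc-adj t G (inj₂ tt) (inj₂ tt) = false

sumM : ∀ {n t} → (MVertex n t → ℕ) → ℕ
sumM {n} {t} h =
  h (inj₂ tt) + sum (map (λ x → sum (map (λ i → h (inj₁ (x , i))) (allFin t))) (allFin n))

myc-deg : ∀ {n} (t : ℕ) → SimpleGraph n → MVertex n t → ℕ
myc-deg t G v = sumM (λ w → if myc-adj t G v w then 1 else 0)

MycRegular : ∀ {n} (t : ℕ) → SimpleGraph n → Set
MycRegular {n} t G = ∃[ r ] (∀ (v : MVertex n t) → myc-deg t G v ≡ r)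

-- M_t(G) is distance magic: a bijection f onto {1,…,N} (N = n*t + 1),
-- realised as w ↦ 1 + toℕ (g w) for a bijection g : V(M_t(G)) ⤖ Fin N,
-- and a constant k equal to every open-neighbourhood label sum.
MycDistanceMagic : ∀ {n} (t : ℕ) → SimpleGraph n → Set
MycDistanceMagic {n} t G =
  Σ (MVertex n t ⤖ Fin (suc (n * t))) λ g → ∃[ k ] (∀ (v : MVertex n t) →
    sumM (λ w → if myc-adj t G v w then suc (toℕ (Bijection.to g w)) else 0) ≡ k)

{-# OPTIONS --safe #-}
module Submission where

-- Fix a vertex x of G with degree d. In M_t(G) the vertex (x,0) has degree 2d, while
-- (x,t-1) has degree d + 1 (its neighbours in layer t-2 and u), so regularity forces
-- d = 1; let y be the unique neighbour of x. For t ≥ 3 the neighbourhoods of (x,0) and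
-- (x,1) consist of the copies of y in layers 0,1 and in layers 0,2 respectively, so
-- equal label sums give f(y,1) = f(y,2), contradicting injectivity of f.

open import Defs
open import Data.Nat using (ℕ; _≤_; _<_; zero; suc; _+_; _∸_; _≡ᵇ_; s≤s; z<s; s<s)
open import Data.Nat.Properties
  using (+-identityʳ; +-cancelʳ-≡; +-cancelˡ-≡; suc-injective; n≤1+n; +-commutativeSemigroup)
open import Algebra.Properties.CommutativeSemigroup +-commutativeSemigroup using (interchange)
open import Data.Nat.ListAction using (sum)
open import Data.Bool using (Bool; true; false; if_then_else_; _∧_; _∨_)
open import Data.Fin using (Fin; toℕ; fromℕ; fromℕ<)
import Data.Fin as Fin
open import Data.Fin.Patterns using (0F; 1F; 2F)
open import Data.Fin.Properties using (toℕ-fromℕ; toℕ-injective; toℕ<n)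
open import Data.List using (List; []; _∷_; map; allFin; tabulate)
open import Data.List.Properties using (map-cong; map-tabulate)
open import Data.Product using (Σ; ∃-syntax; _,_)
open import Data.Sum using (inj₁; inj₂)
open import Data.Unit using (tt)
open import Function using (id)
open import Function.Bundles using (Bijection)
open import Relation.Nullary using (¬_)
open import Relation.Binary.PropositionalEquality

module _ {A : Set} where

  sumWhere : List A → (A → Bool) → (A → ℕ) → ℕ
  sumWhere xs p f = sum (map (λ x → if p x then f x else 0) xs)

  sum-map-zero : (xs : List A) → sum (map (λ _ → 0) xs) ≡ 0
  sum-map-zero []       = refl
  sum-map-zero (_ ∷ xs) = sum-map-zero xs

  sumWhere-∧ˡ : ∀ (xs : List A) b p f →
                sumWhere xs (λ x → b ∧ p x) f ≡ (if b then sumWhere xs p f else 0)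
  sumWhere-∧ˡ xs true  p f = refl
  sumWhere-∧ˡ xs false p f = sum-map-zero xs

  sumWhere-+ : ∀ (xs : List A) p f g →
               sumWhere xs p (λ x → f x + g x) ≡ sumWhere xs p f + sumWhere xs p g
  sumWhere-+ []       p f g = refl
  sumWhere-+ (x ∷ xs) p f g with p x
  ... | false = sumWhere-+ xs p f g
  ... | true  = trans (cong (f x + g x +_) (sumWhere-+ xs p f g))
                      (interchange (f x) (g x) (sumWhere xs p f) (sumWhere xs p g))

  count : List A → (A → Bool) → ℕ
  count xs p = sumWhere xs p (λ _ → 1)

  sumWhere-count-zero : ∀ (xs : List A) p f → count xs p ≡ 0 → sumWhere xs p f ≡ 0
  sumWhere-count-zero []       p f _ = refl
  sumWhere-count-zero (x ∷ xs) p f c with p x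
  ... | false = sumWhere-count-zero xs p f c
  ... | true  with () ← c

  sumWhere-count-one : ∀ (xs : List A) p → count xs p ≡ 1 →
                       Σ A λ y → ∀ f → sumWhere xs p f ≡ f y
  sumWhere-count-one []       p ()
  sumWhere-count-one (x ∷ xs) p c with p x
  ... | false = sumWhere-count-one xs p c
  ... | true  = x , λ f →
    trans (cong (f x +_) (sumWhere-count-zero xs p f (suc-injective c))) (+-identityʳ (f x))

sum-map-allFin : ∀ {N} (f : Fin N → ℕ) → sum (map f (allFin N)) ≡ sum (tabulate f)
sum-map-allFin f = cong sum (map-tabulate id f)

sum-tabulate-zero : ∀ N → sum (tabulate {n = N} (λ _ → 0)) ≡ 0
sum-tabulate-zero zero    = refl
sum-tabulate-zero (suc N) = sum-tabulate-zero N

sum-tabulate-≡ᵇ : ∀ {b N} (b<N : b < N) (f : Fin N → ℕ) →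
                  sum (tabulate (λ j → if b ≡ᵇ toℕ j then f j else 0)) ≡ f (fromℕ< b<N)
sum-tabulate-≡ᵇ {zero}  {suc N} _         f =
  trans (cong (f 0F +_) (sum-tabulate-zero N)) (+-identityʳ _)
sum-tabulate-≡ᵇ {suc b} {suc N} (s<s b<N) f = sum-tabulate-≡ᵇ b<N (λ j → f (Fin.suc j))

≡ᵇ-refl : ∀ m → (m ≡ᵇ m) ≡ true
≡ᵇ-refl zero    = refl
≡ᵇ-refl (suc m) = ≡ᵇ-refl m

<⇒≡ᵇ-false : ∀ {m n} → m < n → (m ≡ᵇ n) ≡ false
<⇒≡ᵇ-false                 z<s       = refl
<⇒≡ᵇ-false {suc m} {suc n} (s<s m<n) = <⇒≡ᵇ-false m<n

-- Copied verbatim from myc-adj, so that neighbourSum-layer holds by unfolding.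
layerAdj : ℕ → ℕ → Bool
layerAdj i j = ((i ≡ᵇ 0) ∧ (j ≡ᵇ 0)) ∨ (j ≡ᵇ suc i) ∨ (i ≡ᵇ suc j)

layerSum : (t : ℕ) → ℕ → (Fin t → ℕ) → ℕ
layerSum t i = sumWhere (allFin t) (λ j → layerAdj i (toℕ j))

layerSum-first : ∀ m g → layerSum (suc (suc m)) 0 g ≡ g 0F + g 1F
layerSum-first m g = begin
  layerSum (suc (suc m)) 0 g
    ≡⟨ sum-map-allFin (λ j → if layerAdj 0 (toℕ j) then g j else 0) ⟩
  g 0F + (g 1F + sum (tabulate {n = m} (λ _ → 0)))
    ≡⟨ cong (λ s → g 0F + (g 1F + s)) (sum-tabulate-zero m) ⟩
  g 0F + (g 1F + 0)
    ≡⟨ cong (g 0F +_) (+-identityʳ (g 1F)) ⟩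
  g 0F + g 1F ∎
  where open ≡-Reasoning

layerSum-second : ∀ m g → layerSum (suc (suc (suc m))) 1 g ≡ g 0F + g 2F
layerSum-second m g = begin
  layerSum (suc (suc (suc m))) 1 g
    ≡⟨ sum-map-allFin (λ j → if layerAdj 1 (toℕ j) then g j else 0) ⟩
  g 0F + (g 2F + sum (tabulate {n = m} (λ _ → 0)))
    ≡⟨ cong (λ s → g 0F + (g 2F + s)) (sum-tabulate-zero m) ⟩
  g 0F + (g 2F + 0)
    ≡⟨ cong (g 0F +_) (+-identityʳ (g 2F)) ⟩
  g 0F + g 2F ∎
  where open ≡-Reasoning

layerSum-last : ∀ m g → layerSum (suc (suc m)) (suc m) g ≡ g (fromℕ< (n≤1+n (suc m)))
layerSum-last m g = begin
  layerSum (suc (suc m)) (suc m) g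
    ≡⟨ cong sum (map-cong (λ j → cong (λ b → if b ∨ (m ≡ᵇ toℕ j) then g j else 0)
                                      (<⇒≡ᵇ-false (toℕ<n j)))
                          (allFin _)) ⟩
  sumWhere (allFin _) (λ j → m ≡ᵇ toℕ j) g
    ≡⟨ sum-map-allFin (λ j → if m ≡ᵇ toℕ j then g j else 0) ⟩
  sum (tabulate (λ j → if m ≡ᵇ toℕ j then g j else 0))
    ≡⟨ sum-tabulate-≡ᵇ (n≤1+n (suc m)) g ⟩
  g (fromℕ< (n≤1+n (suc m))) ∎
  where open ≡-Reasoning

module _ {n : ℕ} (G : SimpleGraph n) where

  neighbourSum : (t : ℕ) → MVertex n t → (MVertex n t → ℕ) → ℕ
  neighbourSum t v h = sumM (λ w → if myc-adj t G v w then h w else 0)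

  sumAdj : Fin n → (Fin n → ℕ) → ℕ
  sumAdj x = sumWhere (allFin n) (adj G x)

  degree : Fin n → ℕ
  degree x = count (allFin n) (adj G x)

  neighbourSum-layer : ∀ t x i h →
    neighbourSum t (inj₁ (x , i)) h ≡
      (if toℕ i ≡ᵇ t ∸ 1 then h (inj₂ tt) else 0)
      + sumAdj x (λ y → layerSum t (toℕ i) (λ j → h (inj₁ (y , j))))
  neighbourSum-layer t x i h =
    cong (_ +_) (cong sum (map-cong (λ y → sumWhere-∧ˡ (allFin t) (adj G x y)
                                              (λ j → layerAdj (toℕ i) (toℕ j))
                                              (λ j → h (inj₁ (y , j))))
                                    (allFin n)))

  sumAdj-cong : ∀ x {f g} → (∀ y → f y ≡ g y) → sumAdj x f ≡ sumAdj x g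
  sumAdj-cong x f≗g =
    cong sum (map-cong (λ y → cong (λ s → if adj G x y then s else 0) (f≗g y)) (allFin n))

  neighbourSum-first : ∀ m x h →
    neighbourSum (suc (suc m)) (inj₁ (x , 0F)) h ≡
      sumAdj x (λ y → h (inj₁ (y , 0F))) + sumAdj x (λ y → h (inj₁ (y , 1F)))
  neighbourSum-first m x h = begin
    neighbourSum (suc (suc m)) (inj₁ (x , 0F)) h
      ≡⟨ neighbourSum-layer (suc (suc m)) x 0F h ⟩
    sumAdj x (λ y → layerSum (suc (suc m)) 0 (λ j → h (inj₁ (y , j))))
      ≡⟨ sumAdj-cong x (λ y → layerSum-first m (λ j → h (inj₁ (y , j)))) ⟩
    sumAdj x (λ y → h (inj₁ (y , 0F)) + h (inj₁ (y , 1F)))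
      ≡⟨ sumWhere-+ (allFin n) (adj G x) _ _ ⟩
    sumAdj x (λ y → h (inj₁ (y , 0F))) + sumAdj x (λ y → h (inj₁ (y , 1F))) ∎
    where open ≡-Reasoning

  neighbourSum-second : ∀ m x h →
    neighbourSum (suc (suc (suc m))) (inj₁ (x , 1F)) h ≡
      sumAdj x (λ y → h (inj₁ (y , 0F))) + sumAdj x (λ y → h (inj₁ (y , 2F)))
  neighbourSum-second m x h = begin
    neighbourSum (suc (suc (suc m))) (inj₁ (x , 1F)) h
      ≡⟨ neighbourSum-layer (suc (suc (suc m))) x 1F h ⟩
    sumAdj x (λ y → layerSum (suc (suc (suc m))) 1 (λ j → h (inj₁ (y , j))))
      ≡⟨ sumAdj-cong x (λ y → layerSum-second m (λ j → h (inj₁ (y , j)))) ⟩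
    sumAdj x (λ y → h (inj₁ (y , 0F)) + h (inj₁ (y , 2F)))
      ≡⟨ sumWhere-+ (allFin n) (adj G x) _ _ ⟩
    sumAdj x (λ y → h (inj₁ (y , 0F))) + sumAdj x (λ y → h (inj₁ (y , 2F))) ∎
    where open ≡-Reasoning

  neighbourSum-last : ∀ m x h →
    neighbourSum (suc (suc m)) (inj₁ (x , fromℕ (suc m))) h ≡
      h (inj₂ tt) + sumAdj x (λ y → h (inj₁ (y , fromℕ< (n≤1+n (suc m)))))
  neighbourSum-last m x h = begin
    neighbourSum (suc (suc m)) (inj₁ (x , fromℕ (suc m))) h
      ≡⟨ neighbourSum-layer (suc (suc m)) x (fromℕ (suc m)) h ⟩
    layerTerms (toℕ (fromℕ (suc m)))
      ≡⟨ cong layerTerms (toℕ-fromℕ (suc m)) ⟩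
    layerTerms (suc m)
      ≡⟨ cong₂ _+_ (cong (λ b → if b then h (inj₂ tt) else 0) (≡ᵇ-refl m))
                   (sumAdj-cong x (λ y → layerSum-last m (λ j → h (inj₁ (y , j))))) ⟩
    h (inj₂ tt) + sumAdj x (λ y → h (inj₁ (y , fromℕ< (n≤1+n (suc m))))) ∎
    where
      open ≡-Reasoning
      layerTerms : ℕ → ℕ
      layerTerms k = (if k ≡ᵇ suc m then h (inj₂ tt) else 0)
                     + sumAdj x (λ y → layerSum (suc (suc m)) k (λ j → h (inj₁ (y , j))))

  degree-first : ∀ m x → myc-deg (suc (suc m)) G (inj₁ (x , 0F)) ≡ degree x + degree x
  degree-first m x = neighbourSum-first m x (λ _ → 1)

  degree-last : ∀ m x → myc-deg (suc (suc m)) G (inj₁ (x , fromℕ (suc m))) ≡ 1 + degree x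
  degree-last m x = neighbourSum-last m x (λ _ → 1)

  regular⇒degree≡1 : ∀ m → MycRegular (suc (suc m)) G → ∀ x → degree x ≡ 1
  regular⇒degree≡1 m (r , regular) x = +-cancelʳ-≡ (degree x) (degree x) 1 (begin
    degree x + degree x
      ≡⟨ degree-first m x ⟨
    myc-deg (suc (suc m)) G (inj₁ (x , 0F))
      ≡⟨ regular (inj₁ (x , 0F)) ⟩
    r
      ≡⟨ regular (inj₁ (x , fromℕ (suc m))) ⟨
    myc-deg (suc (suc m)) G (inj₁ (x , fromℕ (suc m)))
      ≡⟨ degree-last m x ⟩
    1 + degree x ∎)
    where open ≡-Reasoning

  constant-neighbourSum⇒second≡third : ∀ m h k →
    (∀ v → neighbourSum (suc (suc (suc m))) v h ≡ k) → ∀ x →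
    sumAdj x (λ y → h (inj₁ (y , 1F))) ≡ sumAdj x (λ y → h (inj₁ (y , 2F)))
  constant-neighbourSum⇒second≡third m h k constant x =
    +-cancelˡ-≡ (sumAdj x (λ y → h (inj₁ (y , 0F)))) _ _ (begin
      _ ≡⟨ neighbourSum-first (suc m) x h ⟨
      neighbourSum (suc (suc (suc m))) (inj₁ (x , 0F)) h
        ≡⟨ constant (inj₁ (x , 0F)) ⟩
      k ≡⟨ constant (inj₁ (x , 1F)) ⟨
      neighbourSum (suc (suc (suc m))) (inj₁ (x , 1F)) h
        ≡⟨ neighbourSum-second m x h ⟩
      _ ∎)
    where open ≡-Reasoning

  constant-neighbourSum⇒collision : ∀ m h k →
    (∀ v → neighbourSum (suc (suc (suc m))) v h ≡ k) → ∀ x → degree x ≡ 1 →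
    ∃[ y ] h (inj₁ (y , 1F)) ≡ h (inj₁ (y , 2F))
  constant-neighbourSum⇒collision m h k constant x deg≡1
    with y , sumAdj≡ ← sumWhere-count-one (allFin n) (adj G x) deg≡1
    = y , (begin
      h (inj₁ (y , 1F))
        ≡⟨ sumAdj≡ (λ z → h (inj₁ (z , 1F))) ⟨
      sumAdj x (λ z → h (inj₁ (z , 1F)))
        ≡⟨ constant-neighbourSum⇒second≡third m h k constant x ⟩
      sumAdj x (λ z → h (inj₁ (z , 2F)))
        ≡⟨ sumAdj≡ (λ z → h (inj₁ (z , 2F))) ⟩
      h (inj₁ (y , 2F)) ∎)
    where open ≡-Reasoning

proposition2p14 : (t : ℕ) → 3 ≤ t → {n : ℕ} → (G : SimpleGraph n) → Connected G →
                    MycRegular t G → ¬ MycDistanceMagic t G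
-- Connectedness is only needed to supply a vertex x.
proposition2p14 (suc (suc (suc m))) (s≤s (s≤s (s≤s _))) G (x , _) regular (g , k , magic) =
  let y , same-label = constant-neighbourSum⇒collision G m label k magic x
                         (regular⇒degree≡1 G (suc m) regular x)
  in layers-differ (injective (toℕ-injective (suc-injective same-label)))
  where
    open Bijection g using (to; injective)

    label : MVertex _ (suc (suc (suc m))) → ℕ
    label w = suc (toℕ (to w))

    layers-differ : ∀ {y} →
      _≢_ {A = MVertex _ (suc (suc (suc m)))} (inj₁ (y , 1F)) (inj₁ (y , 2F))
    layers-differ ()
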